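{- The maximum, over all words $w$ of length $n$, of the number of distinct pairs $(p,h)$ such that $w$ has abelian period $p$ with preperiod $h$ is $\Theta(n^2)$. That is, there is a constant $c>0$ such that for all sufficiently large $n$ there exists a word of length $n$ with at least $cn^2$ such pairs (and trivially every word of length $n$ has $O(n^2)$ such pairs).
   Context: For a finite word $u$ over an ordered alphabet, $\mathcal{P}(u)$ denotes its Parikh vector (the vector of numbers of occurrences of each letter in $u$) and $|\mathcal{P}(u)|$ its norm (sum of the components, i.e. $|u|$). Write $\mathcal{P}(u)\subset\mathcal{P}(v)$ if $\mathcal{P}(u)$ is componentwise smaller than or equal to $\mathcal{P}(v)$ and $|\mathcal{P}(u)|<|\mathcal{P}(v)|$. A word $w$ has abelian period $p$ with preperiod $h$ if $w=u_0u_1\cdots u_{m-1}u_m$ for some words $u_0,\ldots,u_m$ such that $\mathcal{P}(u_0)\subset\mathcal{P}(u_1)=\cdots=\mathcal{P}(u_{m-1})\supset\mathcal{P}(u_m)$, $|\mathcal{P}(u_0)|=h$ and $|\mathcal{P}(u_1)|=p$. -}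

module Defs where

open import Data.Nat using (ℕ; _≤_; _<_)
open import Data.Fin using (Fin; _≟_)
open import Data.List using (List; length; filter; concat; _++_)
open import Data.List.Relation.Unary.All using (All)
open import Data.Vec using (Vec; tabulate; lookup)
open import Data.Product using (Σ; _×_)
open import Relation.Binary.PropositionalEquality using (_≡_)

Word : ℕ → Set
Word σ = List (Fin σ)

parikh : {σ : ℕ} → Word σ → Vec ℕ σ
parikh w = tabulate (λ a → length (filter (_≟ a) w))

-- Norm of a Parikh vector of u is |u| = length u.
-- P(u) ⊂ P(v): componentwise ≤ and strictly smaller norm.
_⊂P_ : {σ : ℕ} → Word σ → Word σ → Set
u ⊂P v = (∀ a → lookup (parikh u) a ≤ lookup (parikh v) a) × length u < length v

-- w has abelian period p with preperiod h:
-- w = u₀ u₁ ⋯ u_{m-1} u_m with m ≥ 2, here written w = u₀ ++ u₁ ++ concat mids ++ u_m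
-- where mids = u₂ ⋯ u_{m-1}, P(u₀) ⊂ P(u₁) = P(u₂) = ⋯ = P(u_{m-1}) ⊃ P(u_m),
-- |u₀| = h, |u₁| = p.
HasAbelianPeriod : {σ : ℕ} → Word σ → ℕ → ℕ → Set
HasAbelianPeriod {σ} w p h =
  Σ (Word σ) λ u₀ → Σ (Word σ) λ u₁ → Σ (List (Word σ)) λ mids → Σ (Word σ) λ uₘ →
    (w ≡ u₀ ++ u₁ ++ concat mids ++ uₘ)
    × All (λ u → parikh u ≡ parikh u₁) mids
    × (u₀ ⊂P u₁)
    × (uₘ ⊂P u₁)
    × (length u₀ ≡ h)
    × (length u₁ ≡ p)

IsPeriodPair : {σ : ℕ} → Word σ → ℕ × ℕ → Set
IsPeriodPair w (p Data.Product., h) = HasAbelianPeriod w p h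

{-# OPTIONS --safe #-}
-- The unary word xⁿ has abelian period p with preperiod h whenever h < p and h + p ≤ n:
-- cut it into xʰ, as many blocks xᵖ as fit, and a remainder shorter than p.  Taking
-- k = ⌊n/3⌋, the k² pairs with k ≤ p < 2k and h < k all qualify, which gives the
-- quadratic lower bound.  Conversely every pair satisfies h < p ≤ n, and there are
-- only n² such pairs.
module Submission where

open import Defs
open import Data.Nat using (ℕ; zero; suc; _≤_; _<_; _*_; _+_; _∸_; z≤n; s≤s)
open import Data.Nat.Properties hiding (_≟_)
open import Data.Nat.DivMod using (_/_; _%_; m≡m%n+[m/n]*n; m%n<n; m/n*n≤m; m≥n⇒m/n>0)
open import Data.Nat.Solver using (module +-*-Solver)
open import Data.Fin as Fin using (Fin; _≟_)
open import Data.Vec using (lookup)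
open import Data.Vec.Properties using (lookup∘tabulate)
open import Data.List using (List; []; _∷_; length; filter; concat; _++_; replicate; map; cartesianProduct; upTo)
open import Data.List.Properties
  using (length-++; length-++-≤ˡ; length-++-≤ʳ; length-map; length-upTo; length-replicate; filter-++; length-removeAt′)
open import Data.List.Relation.Unary.All as All using (All)
open import Data.List.Relation.Unary.All.Properties using (replicate⁺)
open import Data.List.Relation.Unary.AllPairs using (_∷_)
open import Data.List.Relation.Unary.Any using (here; there; _─_)
open import Data.List.Relation.Unary.Unique.Propositional using (Unique)
import Data.List.Relation.Unary.Unique.Propositional.Properties as Unique
open import Data.List.Membership.Propositional using (_∈_)
open import Data.List.Membership.Propositional.Properties
  using (∈-cartesianProduct⁺; ∈-cartesianProduct⁻; ∈-upTo⁺; ∈-upTo⁻; ∈-map⁺; ∈-map⁻)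
open import Data.List.Relation.Binary.Subset.Propositional using (_⊆_)
open import Data.Product using (Σ; _×_; _,_)
open import Data.Empty using (⊥-elim)
open import Relation.Binary.PropositionalEquality
  using (_≡_; _≢_; refl; sym; trans; cong; cong₂; subst; module ≡-Reasoning)

module _ {A : Set} where

  ∈-─⁺ : ∀ {x y} {ys : List A} (x∈ys : x ∈ ys) → y ∈ ys → x ≢ y → y ∈ (ys ─ x∈ys)
  ∈-─⁺ (here refl)  (here refl)  x≢y = ⊥-elim (x≢y refl)
  ∈-─⁺ (here refl)  (there y∈ys) _   = y∈ys
  ∈-─⁺ (there _)    (here refl)  _   = here refl
  ∈-─⁺ (there x∈ys) (there y∈ys) x≢y = there (∈-─⁺ x∈ys y∈ys x≢y)

  Unique-⊆⇒length-≤ : ∀ {xs ys : List A} → Unique xs → xs ⊆ ys → length xs ≤ length ys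
  Unique-⊆⇒length-≤ {[]}          _            _     = z≤n
  Unique-⊆⇒length-≤ {x ∷ xs} {ys} (x∉xs ∷ xs!) xs⊆ys = begin
    suc (length xs)          ≤⟨ s≤s (Unique-⊆⇒length-≤ xs! xs⊆ys─x) ⟩
    suc (length (ys ─ x∈ys)) ≡⟨ length-removeAt′ ys _ ⟨
    length ys                ∎
    where
    open ≤-Reasoning
    x∈ys : x ∈ ys
    x∈ys = xs⊆ys (here refl)
    xs⊆ys─x : xs ⊆ (ys ─ x∈ys)
    xs⊆ys─x y∈xs = ∈-─⁺ x∈ys (xs⊆ys (there y∈xs)) (All.lookup x∉xs y∈xs)

  replicate-+ : ∀ m n (x : A) → replicate (m + n) x ≡ replicate m x ++ replicate n x
  replicate-+ zero    n x = refl
  replicate-+ (suc m) n x = cong (x ∷_) (replicate-+ m n x)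

  concat-replicate-replicate : ∀ q p (x : A) → concat (replicate q (replicate p x)) ≡ replicate (q * p) x
  concat-replicate-replicate zero    p x = refl
  concat-replicate-replicate (suc q) p x = begin
    replicate p x ++ concat (replicate q (replicate p x)) ≡⟨ cong (replicate p x ++_) (concat-replicate-replicate q p x) ⟩
    replicate p x ++ replicate (q * p) x                  ≡⟨ replicate-+ p (q * p) x ⟨
    replicate (p + q * p) x                               ∎
    where open ≡-Reasoning

length-cartesianProduct : ∀ {A B : Set} (xs : List A) (ys : List B) →
  length (cartesianProduct xs ys) ≡ length xs * length ys
length-cartesianProduct []       ys = refl
length-cartesianProduct (x ∷ xs) ys = begin
  length (map (x ,_) ys ++ cartesianProduct xs ys)         ≡⟨ length-++ (map (x ,_) ys) ⟩
  length (map (x ,_) ys) + length (cartesianProduct xs ys) ≡⟨ cong₂ _+_ (length-map (x ,_) ys) (length-cartesianProduct xs ys) ⟩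
  length ys + length xs * length ys                        ∎
  where open ≡-Reasoning

box : ℕ → ℕ → ℕ → List (ℕ × ℕ)
box o k l = cartesianProduct (map (o +_) (upTo k)) (upTo l)

length-box : ∀ o k l → length (box o k l) ≡ k * l
length-box o k l = begin
  length (box o k l)                             ≡⟨ length-cartesianProduct (map (o +_) (upTo k)) (upTo l) ⟩
  length (map (o +_) (upTo k)) * length (upTo l) ≡⟨ cong₂ _*_ (trans (length-map (o +_) (upTo k)) (length-upTo k)) (length-upTo l) ⟩
  k * l                                          ∎
  where open ≡-Reasoning

box-unique : ∀ o k l → Unique (box o k l)
box-unique o k l = Unique.cartesianProduct⁺ (Unique.map⁺ (+-cancelˡ-≡ o _ _) (Unique.upTo⁺ k)) (Unique.upTo⁺ l)

∈-box⁺ : ∀ {o k l i j} → i < k → j < l → (o + i , j) ∈ box o k l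
∈-box⁺ i<k j<l = ∈-cartesianProduct⁺ (∈-map⁺ (_ +_) (∈-upTo⁺ i<k)) (∈-upTo⁺ j<l)

∈-box⁻ : ∀ {o k l p h} → (p , h) ∈ box o k l → o ≤ p × p < o + k × h < l
∈-box⁻ {o} {k} {l} mem with ∈-cartesianProduct⁻ (map (o +_) (upTo k)) (upTo l) mem
... | p∈ , h∈ with ∈-map⁻ (o +_) p∈
...   | i , i∈ , refl = m≤m+n o i , +-monoʳ-< o (∈-upTo⁻ i∈) , ∈-upTo⁻ h∈

module _ {σ : ℕ} where

  parikh-++-≤ˡ : ∀ (u v : Word σ) a → lookup (parikh u) a ≤ lookup (parikh (u ++ v)) a
  parikh-++-≤ˡ u v a = begin
    lookup (parikh u) a                         ≡⟨ lookup∘tabulate _ a ⟩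
    length (filter (_≟ a) u)                    ≤⟨ length-++-≤ˡ (filter (_≟ a) u) ⟩
    length (filter (_≟ a) u ++ filter (_≟ a) v) ≡⟨ cong length (filter-++ (_≟ a) u v) ⟨
    length (filter (_≟ a) (u ++ v))             ≡⟨ lookup∘tabulate _ a ⟨
    lookup (parikh (u ++ v)) a                  ∎
    where open ≤-Reasoning

  ⊂P-++ : ∀ (u v : Word σ) → 0 < length v → u ⊂P (u ++ v)
  ⊂P-++ u v 0<|v| = parikh-++-≤ˡ u v , (begin-strict
    length u            <⟨ m<m+n (length u) 0<|v| ⟩
    length u + length v ≡⟨ length-++ u ⟨
    length (u ++ v)     ∎)
    where open ≤-Reasoning

  replicate-⊂P : ∀ {m n} (x : Fin σ) → m < n → replicate m x ⊂P replicate n x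
  replicate-⊂P {m} {n} x m<n = subst (replicate m x ⊂P_) split
    (⊂P-++ (replicate m x) (replicate (n ∸ m) x)
      (subst (0 <_) (sym (length-replicate (n ∸ m))) (m<n⇒0<n∸m m<n)))
    where
    split : replicate m x ++ replicate (n ∸ m) x ≡ replicate n x
    split = trans (sym (replicate-+ m (n ∸ m) x)) (cong (λ k → replicate k x) (m+[n∸m]≡n (<⇒≤ m<n)))

  replicate-hasAbelianPeriod : ∀ {n p h} (x : Fin σ) → h < p → h + p ≤ n → HasAbelianPeriod (replicate n x) p h
  replicate-hasAbelianPeriod {n} {p@(suc _)} {h} x h<p h+p≤n =
    rep h , rep p , replicate q (rep p) , rep r ,
    blocks , replicate⁺ q refl , replicate-⊂P x h<p , replicate-⊂P x (m%n<n t p) ,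
    length-replicate h , length-replicate p
    where
    rep : ℕ → Word σ
    rep k = replicate k x
    t q r : ℕ
    t = n ∸ (h + p)
    q = t / p
    r = t % p
    lengths : n ≡ h + (p + (q * p + r))
    lengths = begin
      n                       ≡⟨ m+[n∸m]≡n h+p≤n ⟨
      (h + p) + t             ≡⟨ cong ((h + p) +_) (trans (m≡m%n+[m/n]*n t p) (+-comm r (q * p))) ⟩
      (h + p) + (q * p + r)   ≡⟨ +-assoc h p (q * p + r) ⟩
      h + (p + (q * p + r))   ∎
      where open ≡-Reasoning
    blocks : rep n ≡ rep h ++ rep p ++ concat (replicate q (rep p)) ++ rep r
    blocks = begin
      rep n                                                   ≡⟨ cong rep lengths ⟩
      rep (h + (p + (q * p + r)))                             ≡⟨ replicate-+ h _ x ⟩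
      rep h ++ rep (p + (q * p + r))                          ≡⟨ cong (rep h ++_) (replicate-+ p _ x) ⟩
      rep h ++ rep p ++ rep (q * p + r)                       ≡⟨ cong (λ u → rep h ++ rep p ++ u) (replicate-+ (q * p) r x) ⟩
      rep h ++ rep p ++ rep (q * p) ++ rep r                  ≡⟨ cong (λ u → rep h ++ rep p ++ u ++ rep r) (concat-replicate-replicate q p x) ⟨
      rep h ++ rep p ++ concat (replicate q (rep p)) ++ rep r ∎
      where open ≡-Reasoning

  hasAbelianPeriod⇒<×≤length : ∀ {w : Word σ} {p h} → HasAbelianPeriod w p h → h < p × p ≤ length w
  hasAbelianPeriod⇒<×≤length (u₀ , u₁ , _ , _ , refl , _ , (_ , h<p) , _ , refl , refl) =
    h<p , ≤-trans (length-++-≤ˡ u₁) (length-++-≤ʳ (u₁ ++ _) {u₀})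

box-periodPairs : ∀ {σ n} (x : Fin σ) k → k * 3 ≤ n → All (IsPeriodPair (replicate n x)) (box k k k)
box-periodPairs x k 3k≤n = All.tabulate λ { {p , h} mem → periodPair (∈-box⁻ mem) }
  where
  open +-*-Solver
  periodPair : ∀ {p h} → k ≤ p × p < k + k × h < k → HasAbelianPeriod (replicate _ x) p h
  periodPair {p} {h} (k≤p , p<2k , h<k) = replicate-hasAbelianPeriod x (<-≤-trans h<k k≤p) (begin
    h + p         ≤⟨ +-mono-≤ (<⇒≤ h<k) (<⇒≤ p<2k) ⟩
    k + (k + k)   ≡⟨ solve 1 (λ k → k :+ (k :+ k) := k :* con 3) refl k ⟩
    k * 3         ≤⟨ 3k≤n ⟩
    _             ∎)
    where open ≤-Reasoning

n≤5*[n/3] : ∀ n → 3 ≤ n → n ≤ 5 * (n / 3)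
n≤5*[n/3] n 3≤n = begin
  n                ≡⟨ m≡m%n+[m/n]*n n 3 ⟩
  n % 3 + k * 3    ≤⟨ +-monoˡ-≤ (k * 3) (≤-trans (≤-pred (m%n<n n 3)) (*-monoʳ-≤ 2 (m≥n⇒m/n>0 3≤n))) ⟩
  2 * k + k * 3    ≡⟨ solve 1 (λ k → con 2 :* k :+ k :* con 3 := con 5 :* k) refl k ⟩
  5 * k            ∎
  where
  open ≤-Reasoning
  open +-*-Solver
  k : ℕ
  k = n / 3

quadratic-lowerBound : ∀ {σ} (x : Fin σ) n → 3 ≤ n →
  Σ (List (ℕ × ℕ)) λ ps → Unique ps × All (IsPeriodPair (replicate n x)) ps × 1 * (n * n) ≤ 25 * length ps
quadratic-lowerBound x n 3≤n = box k k k , box-unique k k k , box-periodPairs x k (m/n*n≤m n 3) , (begin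
  1 * (n * n)              ≡⟨ *-identityˡ (n * n) ⟩
  n * n                    ≤⟨ *-mono-≤ (n≤5*[n/3] n 3≤n) (n≤5*[n/3] n 3≤n) ⟩
  (5 * k) * (5 * k)        ≡⟨ solve 1 (λ k → (con 5 :* k) :* (con 5 :* k) := con 25 :* (k :* k)) refl k ⟩
  25 * (k * k)             ≡⟨ cong (25 *_) (length-box k k k) ⟨
  25 * length (box k k k)  ∎)
  where
  open ≤-Reasoning
  open +-*-Solver
  k : ℕ
  k = n / 3

periodPairs⊆box : ∀ {σ} (w : Word σ) {ps} → All (IsPeriodPair w) ps → ps ⊆ box 1 (length w) (length w)
periodPairs⊆box w all {p , h} mem with hasAbelianPeriod⇒<×≤length (All.lookup all mem)
... | h<p@(s≤s _) , p≤n = ∈-box⁺ p≤n (<-≤-trans h<p p≤n)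

quadratic-upperBound : ∀ {σ} (w : Word σ) ps → Unique ps → All (IsPeriodPair w) ps →
  length ps ≤ 1 * (length w * length w)
quadratic-upperBound w ps ps! all = begin
  length ps          ≤⟨ Unique-⊆⇒length-≤ ps! (periodPairs⊆box w all) ⟩
  length (box 1 n n) ≡⟨ length-box 1 n n ⟩
  n * n              ≡⟨ *-identityˡ (n * n) ⟨
  1 * (n * n)        ∎
  where
  open ≤-Reasoning
  n : ℕ
  n = length w

mainTheorem4 : (σ : ℕ) →
    (Σ ℕ λ a → Σ ℕ λ b → Σ ℕ λ N → (0 < a) × (0 < b) ×
      ((n : ℕ) → N ≤ n →
        Σ (Word (suc σ)) λ w → (length w ≡ n) ×
          (Σ (List (ℕ × ℕ)) λ ps → Unique ps × All (IsPeriodPair w) ps ×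
            (a * (n * n) ≤ b * length ps))))
    ×
    (Σ ℕ λ C → (w : Word (suc σ)) → (ps : List (ℕ × ℕ)) →
      Unique ps → All (IsPeriodPair w) ps →
      length ps ≤ C * (length w * length w))
mainTheorem4 σ =
  (1 , 25 , 3 , s≤s z≤n , s≤s z≤n ,
    λ n 3≤n → replicate n Fin.zero , length-replicate n , quadratic-lowerBound Fin.zero n 3≤n) ,
  (1 , quadratic-upperBound)
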